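{- For each integer $k\ge 2$, the graph $H_k$ satisfies $\beta(H_k)=2$ and $\overline{\varphi}(H_k)\ge k$.
   Context: Graphs are finite, may have parallel edges but no loops; $G$ contains $H$ if $H$ is a subgraph. A circuit is a connected 2-regular graph; a path is a circuit minus an edge; odd/even refers to the number of edges. An ear of a subgraph $H$ of $G$ is a path of $G$ having exactly its two distinct ends in $H$. An ear-decomposition of $G$ is a sequence $(C,P_1,\dots,P_m)$ with $C$ a circuit, $G=C\cup P_1\cup\dots\cup P_m$, each $P_i$ an ear of $C\cup P_1\cup\dots\cup P_{i-1}$; its ears are $C,P_1,\dots,P_m$, and it is odd if all ears are odd. $\beta(G)$ is the largest $k$ such that $G$ contains a graph having an odd ear-decomposition with $k$ ears. For a 2-connected graph $G$, $\varphi(G)$ is the smallest number of even ears in an ear-decomposition of $G$ and $\overline{\varphi}(G):=|E(G)|-|V(G)|+1-\varphi(G)$, i.e. the largest number of odd ears in an ear-decomposition of $G$. Construction of $H_k$: take $k$ vertex-disjoint copies $T_1,\dots,T_k$ of the simple graph obtained from a circuit of length 5 by adding one chord (so $T_i$ consists of a triangle and a 4-circuit sharing an edge); let $v_i$ be the unique vertex of degree 2 of the triangle of $T_i$ and $u_i$ one of its neighbours. $H_k$ is obtained by identifying all $v_i$ into a single vertex $v$, all $u_i$ into a single vertex $u$, and keeping only one copy of the edge $uv$. -}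

module Defs where

open import Data.Nat using (ℕ; zero; suc; _+_; _≤_)
open import Data.Fin using (Fin)
open import Data.Product using (Σ; ∃; _×_; _,_; proj₁; proj₂)
open import Data.Sum using (_⊎_)
open import Data.Unit using (⊤)
open import Data.Empty using (⊥)
open import Data.List using (List; []; _∷_; map; length; _++_; concatMap; last; filter)
open import Data.Maybe using (Maybe; just; nothing)
open import Data.List.Relation.Unary.All using (All)
open import Data.List.Relation.Unary.Unique.Propositional using (Unique)
open import Data.List.Membership.Propositional using (_∈_; _∉_)
open import Relation.Binary.PropositionalEquality using (_≡_; _≢_)
open import Relation.Nullary using (¬_)

-- Graphs: loopless multigraphs (parallel edges allowed).
-- Each edge has an (unordered) pair of distinct end vertices, given
-- here as an ordered pair which is only used up to swapping.

record Multigraph : Set₁ where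
  field
    V    : Set
    E    : Set
    ends : E → V × V
    loopless : ∀ e → proj₁ (ends e) ≢ proj₂ (ends e)

open Multigraph public

Joins : (G : Multigraph) → E G → V G → V G → Set
Joins G e x y = (ends G e ≡ (x , y)) ⊎ (ends G e ≡ (y , x))

IsOdd : ℕ → Set
IsOdd n = ∃ λ m → n ≡ suc (m + m)

-- Walks: a start vertex x₀ and a list of steps (e₁ , x₁) … (eₗ , xₗ)
-- where eⱼ joins xⱼ₋₁ and xⱼ.

Walk : Multigraph → Set
Walk G = V G × List (E G × V G)

StepsOK : (G : Multigraph) → V G → List (E G × V G) → Set
StepsOK G x []            = ⊤
StepsOK G x ((e , y) ∷ s) = Joins G e x y × StepsOK G y s

verts : {G : Multigraph} → Walk G → List (V G)
verts (x , s) = x ∷ map proj₂ s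

edges : {G : Multigraph} → Walk G → List (E G)
edges (x , s) = map proj₁ s

len : {G : Multigraph} → Walk G → ℕ
len (x , s) = length s

start : {G : Multigraph} → Walk G → V G
start (x , s) = x

lastVertex : {G : Multigraph} → V G → List (E G × V G) → V G
lastVertex {G} x [] = x
lastVertex {G} x ((e , y) ∷ s) = lastVertex {G} y s

finish : {G : Multigraph} → Walk G → V G
finish {G} (x , s) = lastVertex {G} x s

IsPath : (G : Multigraph) → Walk G → Set
IsPath G (x , s) =
  StepsOK G x s × 1 ≤ length s × Unique (verts {G} (x , s)) × Unique (map proj₁ s)

-- A circuit of G (connected 2-regular subgraph): a closed walk
-- x₀ e₁ x₁ … eₗ xₗ = x₀ with l ≥ 2, the vertices x₁ … xₗ distinct and
-- the edges distinct (l = 2 gives two parallel edges).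
IsCircuit : (G : Multigraph) → Walk G → Set
IsCircuit G (x , s) =
  StepsOK G x s × 2 ≤ length s × finish {G} (x , s) ≡ x
  × Unique (map proj₂ s) × Unique (map proj₁ s)

-- The subgraph H built so far is given by its vertex list Vs and
-- edge list Es.

IsEarOf : (G : Multigraph) → List (V G) → List (E G) → Walk G → Set
IsEarOf G Vs Es P =
  IsPath G P × start {G} P ∈ Vs × finish {G} P ∈ Vs
  × All (λ y → y ∈ Vs → (y ≡ start {G} P) ⊎ (y ≡ finish {G} P)) (verts {G} P)
  × All (λ e → e ∉ Es) (edges {G} P)

EarsOK : (G : Multigraph) → List (V G) → List (E G) → List (Walk G) → Set
EarsOK G Vs Es []       = ⊤
EarsOK G Vs Es (P ∷ Ps) =
  IsEarOf G Vs Es P × EarsOK G (verts {G} P ++ Vs) (edges {G} P ++ Es) Ps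

-- An ear-decomposition (C , P₁ , … , Pₘ), given as the list of its ears
-- C ∷ P₁ ∷ … ∷ Pₘ, of the subgraph C ∪ P₁ ∪ … ∪ Pₘ of G.
IsEarDecomposition : (G : Multigraph) → List (Walk G) → Set
IsEarDecomposition G []       = ⊥
IsEarDecomposition G (C ∷ Ps) =
  IsCircuit G C × EarsOK G (verts {G} C) (edges {G} C) Ps

Spanning : (G : Multigraph) → List (Walk G) → Set
Spanning G ears =
  (∀ (x : V G) → x ∈ concatMap (verts {G}) ears)
  × (∀ (e : E G) → e ∈ concatMap (edges {G}) ears)

-- β(G): the largest k such that G contains a graph having an odd
-- ear-decomposition with k ears.

HasOddEarDecomposition : (G : Multigraph) → ℕ → Set
HasOddEarDecomposition G k =
  Σ (List (Walk G)) λ ears →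
    IsEarDecomposition G ears × All (λ P → IsOdd (len {G} P)) ears
    × length ears ≡ k

BetaIs : Multigraph → ℕ → Set
BetaIs G b =
  HasOddEarDecomposition G b × (∀ k → HasOddEarDecomposition G k → k ≤ b)

NumOddEars : (G : Multigraph) → List (Walk G) → ℕ
NumOddEars G []       = 0
NumOddEars G (P ∷ Ps) = oddOne (len {G} P) + NumOddEars G Ps
  where
  oddOne : ℕ → ℕ
  oddOne zero          = 0
  oddOne (suc zero)    = 1
  oddOne (suc (suc n)) = oddOne n

-- "φ̄(G) ≥ k": φ̄(G) is the largest number of odd ears in an
-- ear-decomposition of G, so φ̄(G) ≥ k iff some ear-decomposition of G
-- has at least k odd ears.
PhiBarAtLeast : Multigraph → ℕ → Set
PhiBarAtLeast G k =
  Σ (List (Walk G)) λ ears →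
    IsEarDecomposition G ears × Spanning G ears × k ≤ NumOddEars G ears

-- T_i: 5-circuit v u e_i d_i c_i v with chord u c_i; triangle v u c_i
-- (v = v_i is the vertex of degree 2 of T_i lying on the triangle,
-- u = u_i a neighbour of it), 4-circuit u c_i d_i e_i.

data HV (k : ℕ) : Set where
  u v : HV k
  c d e : Fin k → HV k

data HE (k : ℕ) : Set where
  uv : HE k
  vc uc cd de eu : Fin k → HE k

HEnds : (k : ℕ) → HE k → HV k × HV k
HEnds k uv     = u , v
HEnds k (vc i) = v , c i
HEnds k (uc i) = u , c i
HEnds k (cd i) = c i , d i
HEnds k (de i) = d i , e i
HEnds k (eu i) = e i , u

HLoopless : (k : ℕ) → ∀ x → proj₁ (HEnds k x) ≢ proj₂ (HEnds k x)
HLoopless k uv     ()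
HLoopless k (vc i) ()
HLoopless k (uc i) ()
HLoopless k (cd i) ()
HLoopless k (de i) ()
HLoopless k (eu i) ()

H : ℕ → Multigraph
H k = record { V = HV k ; E = HE k ; ends = HEnds k ; loopless = HLoopless k }

-- Colour c i and e i black and u, v, d i white: every edge except uv joins the two colours,
-- so an odd circuit, and an odd ear with both ends at the hubs u, v, must use uv.  Hence the
-- circuit of an odd ear-decomposition is the triangle u v c i or the pentagon u v c i d i e i
-- of a single copy T i.  An odd ear of it cannot start at a hub into another copy T j (it would
-- have to leave T j through a hub again, hence be even), so it stays in T i, where it must be
-- the path c i d i e i u, resp. the chord u c i.  Then every edge of T i is used and no third
-- odd ear exists: β(H k) ≤ 2.  Conversely, the triangle and square path of T 0 followed, for
-- every other copy T j, by the even ear v c j u and the odd ear c j d j e j u form an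
-- ear-decomposition of H k with k + 1 odd ears.

module Submission where

open import Defs
open import Data.Bool using (Bool; true; false; not; _xor_)
open import Data.Bool.Properties using (not-¬; not-distribˡ-xor; not-distribʳ-xor; xor-identityʳ; xor-comm)
open import Data.Empty using (⊥; ⊥-elim)
open import Data.Fin using (Fin; zero; suc; _≟_)
open import Data.Fin.Properties using (suc-injective)
open import Data.List using (List; []; _∷_; map; length; _++_; concatMap; allFin)
open import Data.List.Properties using (length-map; length-tabulate)
open import Data.List.Membership.Propositional using (_∈_; _∉_)
open import Data.List.Membership.Propositional.Properties
  using (∈-map⁺; ∈-map⁻; ∈-∃++; ∈-++⁺ʳ; ∈-++⁻; ∈-allFin; ∈-concat⁺′)
open import Data.List.Relation.Binary.Permutation.Propositional using (_↭_; ↭-sym; ↭⇒↭ₛ)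
open import Data.List.Relation.Binary.Permutation.Propositional.Properties using (∈-resp-↭; ++-comm)
  renaming (map⁺ to ↭-map⁺)
import Data.List.Relation.Binary.Permutation.Setoid.Properties as PermutationSetoid
open import Data.List.Relation.Binary.Subset.Propositional using (_⊆_)
open import Data.List.Relation.Unary.All as All using (All; []; _∷_)
open import Data.List.Relation.Unary.All.Properties using (All¬⇒¬Any) renaming (map⁺ to All-map⁺)
open import Data.List.Relation.Unary.AllPairs using ([]; _∷_)
open import Data.List.Relation.Unary.Any using (here; there)
open import Data.List.Relation.Unary.Unique.Propositional using (Unique)
open import Data.List.Relation.Unary.Unique.Propositional.Properties using (allFin⁺)
  renaming (map⁺ to Unique-map⁺)
open import Data.Nat using (ℕ; zero; suc; _+_; _≤_; z≤n; s≤s)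
open import Data.Nat.Properties using (+-suc; ≤-trans; ≤-reflexive; n≤1+n)
open import Data.Product using (∃; _×_; _,_; proj₁; proj₂)
open import Data.Sum using (_⊎_; inj₁; inj₂; [_,_]′)
open import Data.Unit using (⊤; tt)
open import Function using (_∘_)
open import Relation.Binary.PropositionalEquality
  using (_≡_; _≢_; refl; sym; trans; subst; cong; setoid; module ≡-Reasoning)
open import Relation.Nullary using (¬_)
open import Relation.Nullary.Decidable using (decidable-stable)

open ≡-Reasoning

module _ {A : Set} where

  ∉-++ : ∀ {x : A} {xs ys} → x ∉ xs → x ∉ ys → x ∉ xs ++ ys
  ∉-++ {xs = xs} x∉xs x∉ys x∈ = [ x∉xs , x∉ys ]′ (∈-++⁻ xs x∈)

  Unique-resp-↭ : ∀ {xs ys : List A} → xs ↭ ys → Unique xs → Unique ys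
  Unique-resp-↭ σ = PermutationSetoid.Unique-resp-↭ (setoid A) (↭⇒↭ₛ σ)

-- Walks in a multigraph

module _ {G : Multigraph} where

  lastVertex-++ : ∀ x (A B : List (E G × V G)) →
                  lastVertex {G} x (A ++ B) ≡ lastVertex {G} (lastVertex {G} x A) B
  lastVertex-++ x []            B = refl
  lastVertex-++ x ((_ , y) ∷ A) B = lastVertex-++ y A B

  lastVertex-∈ : ∀ x (s : List (E G × V G)) → 1 ≤ length s → lastVertex {G} x s ∈ map proj₂ s
  lastVertex-∈ x ((_ , y) ∷ [])    _ = here refl
  lastVertex-∈ x ((_ , y) ∷ p ∷ s) _ = there (lastVertex-∈ y (p ∷ s) (s≤s z≤n))

  returningWalk-nil : ∀ x (s : List (E G × V G)) →
                      Unique (x ∷ map proj₂ s) → lastVertex {G} x s ≡ x → s ≡ []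
  returningWalk-nil x []      _         _      = refl
  returningWalk-nil x (p ∷ s) (x∉ ∷ _) closed =
    ⊥-elim (All.lookup x∉ (lastVertex-∈ x (p ∷ s) (s≤s z≤n)) (sym closed))

  StepsOK-++⁻ : ∀ x A {B} → StepsOK G x (A ++ B) →
                StepsOK G x A × StepsOK G (lastVertex {G} x A) B
  StepsOK-++⁻ x []            ok       = tt , ok
  StepsOK-++⁻ x ((_ , y) ∷ A) (j , ok) = let okA , okB = StepsOK-++⁻ y A ok in (j , okA) , okB

  StepsOK-++⁺ : ∀ x A {B} → StepsOK G x A → StepsOK G (lastVertex {G} x A) B →
                StepsOK G x (A ++ B)
  StepsOK-++⁺ x []            _         okB = okB
  StepsOK-++⁺ x ((_ , y) ∷ A) (j , okA) okB = j , StepsOK-++⁺ y A okA okB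

  closedWalk-rotate : ∀ x A B → StepsOK G x (A ++ B) → lastVertex {G} x (A ++ B) ≡ x →
                      let y = lastVertex {G} x A in
                      StepsOK G y (B ++ A) × lastVertex {G} y (B ++ A) ≡ y
  closedWalk-rotate x A B ok closed =
    StepsOK-++⁺ y B okB (subst (λ z → StepsOK G z A) (sym B-returns) okA) , (begin
      lastVertex {G} y (B ++ A)              ≡⟨ lastVertex-++ y B A ⟩
      lastVertex {G} (lastVertex {G} y B) A  ≡⟨ cong (λ z → lastVertex {G} z A) B-returns ⟩
      y                                      ∎)
    where
    y = lastVertex {G} x A
    okA = proj₁ (StepsOK-++⁻ x A ok)
    okB = proj₂ (StepsOK-++⁻ x A ok)
    B-returns : lastVertex {G} y B ≡ x
    B-returns = trans (sym (lastVertex-++ x A B)) closed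

  covered⇒Spanning : (ears : List (Walk G)) →
                     (∀ x → ∃ λ P → P ∈ ears × x ∈ verts {G} P) →
                     (∀ e → ∃ λ P → P ∈ ears × e ∈ edges {G} P) →
                     Spanning G ears
  covered⇒Spanning ears coverV coverE =
    (λ x → let P , P∈ , x∈ = coverV x in ∈-concat⁺′ x∈ (∈-map⁺ (verts {G}) P∈)) ,
    (λ e → let P , P∈ , e∈ = coverE e in ∈-concat⁺′ e∈ (∈-map⁺ (edges {G}) P∈))

  PhiBarAtLeast-mono : ∀ {m n} → n ≤ m → PhiBarAtLeast G m → PhiBarAtLeast G n
  PhiBarAtLeast-mono n≤m (ears , decomposition , spanning , m≤) =
    ears , decomposition , spanning , ≤-trans n≤m m≤

-- Walks and parity in H k

oddᵇ : ℕ → Bool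
oddᵇ zero    = false
oddᵇ (suc n) = not (oddᵇ n)

oddᵇ-double : ∀ m → oddᵇ (m + m) ≡ false
oddᵇ-double zero = refl
oddᵇ-double (suc m) rewrite +-suc m m | oddᵇ-double m = refl

IsOdd⇒oddᵇ : ∀ {n} → IsOdd n → oddᵇ n ≡ true
IsOdd⇒oddᵇ (m , refl) = cong not (oddᵇ-double m)

Steps : ℕ → Set
Steps k = List (HE k × HV k)

module _ {k : ℕ} where

  lastV : HV k → Steps k → HV k
  lastV = lastVertex {H k}

  data Adj : HV k → HE k → HV k → Set where
    uv→ : Adj u uv v
    uv← : Adj v uv u
    vc→ : ∀ {i} → Adj v (vc i) (c i)
    vc← : ∀ {i} → Adj (c i) (vc i) v
    uc→ : ∀ {i} → Adj u (uc i) (c i)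
    uc← : ∀ {i} → Adj (c i) (uc i) u
    cd→ : ∀ {i} → Adj (c i) (cd i) (d i)
    cd← : ∀ {i} → Adj (d i) (cd i) (c i)
    de→ : ∀ {i} → Adj (d i) (de i) (e i)
    de← : ∀ {i} → Adj (e i) (de i) (d i)
    eu→ : ∀ {i} → Adj (e i) (eu i) u
    eu← : ∀ {i} → Adj u (eu i) (e i)

  Joins⇒Adj : ∀ {q x y} → Joins (H k) q x y → Adj x q y
  Joins⇒Adj {uv}   (inj₁ refl) = uv→
  Joins⇒Adj {uv}   (inj₂ refl) = uv←
  Joins⇒Adj {vc i} (inj₁ refl) = vc→
  Joins⇒Adj {vc i} (inj₂ refl) = vc←
  Joins⇒Adj {uc i} (inj₁ refl) = uc→
  Joins⇒Adj {uc i} (inj₂ refl) = uc←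
  Joins⇒Adj {cd i} (inj₁ refl) = cd→
  Joins⇒Adj {cd i} (inj₂ refl) = cd←
  Joins⇒Adj {de i} (inj₁ refl) = de→
  Joins⇒Adj {de i} (inj₂ refl) = de←
  Joins⇒Adj {eu i} (inj₁ refl) = eu→
  Joins⇒Adj {eu i} (inj₂ refl) = eu←

  data AdjWalk : HV k → Steps k → Set where
    []  : ∀ {x} → AdjWalk x []
    _∷_ : ∀ {x q y s} → Adj x q y → AdjWalk y s → AdjWalk x ((q , y) ∷ s)

  StepsOK⇒AdjWalk : ∀ x s → StepsOK (H k) x s → AdjWalk x s
  StepsOK⇒AdjWalk x []            _        = []
  StepsOK⇒AdjWalk x ((q , y) ∷ s) (j , ok) = Joins⇒Adj j ∷ StepsOK⇒AdjWalk y s ok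

  colour : HV k → Bool
  colour u     = false
  colour v     = false
  colour (c _) = true
  colour (d _) = false
  colour (e _) = true

  Adj-colour : ∀ {x q y} → Adj x q y → q ≡ uv ⊎ colour y ≡ not (colour x)
  Adj-colour uv→ = inj₁ refl
  Adj-colour uv← = inj₁ refl
  Adj-colour vc→ = inj₂ refl
  Adj-colour vc← = inj₂ refl
  Adj-colour uc→ = inj₂ refl
  Adj-colour uc← = inj₂ refl
  Adj-colour cd→ = inj₂ refl
  Adj-colour cd← = inj₂ refl
  Adj-colour de→ = inj₂ refl
  Adj-colour de← = inj₂ refl
  Adj-colour eu→ = inj₂ refl
  Adj-colour eu← = inj₂ refl

  AdjWalk-parity : ∀ {x s} → AdjWalk x s →
                   uv ∈ map proj₁ s ⊎ colour (lastV x s) ≡ colour x xor oddᵇ (length s)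
  AdjWalk-parity {x} [] = inj₂ (sym (xor-identityʳ (colour x)))
  AdjWalk-parity {x} {(q , y) ∷ s} (a ∷ w) with Adj-colour a | AdjWalk-parity w
  ... | inj₁ refl  | _         = inj₁ (here refl)
  ... | inj₂ _     | inj₁ uv∈  = inj₁ (there uv∈)
  ... | inj₂ flips | inj₂ walk = inj₂ (begin
    colour (lastV y s)                   ≡⟨ walk ⟩
    colour y xor oddᵇ (length s)         ≡⟨ cong (_xor oddᵇ (length s)) flips ⟩
    not (colour x) xor oddᵇ (length s)   ≡⟨ sym (not-distribˡ-xor (colour x) _) ⟩
    not (colour x xor oddᵇ (length s))   ≡⟨ not-distribʳ-xor (colour x) _ ⟩
    colour x xor not (oddᵇ (length s))   ∎)

  oddWalk-sameColour-uses-uv : ∀ {x s} → AdjWalk x s → colour (lastV x s) ≡ colour x →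
                               IsOdd (length s) → uv ∈ map proj₁ s
  oddWalk-sameColour-uses-uv {x} {s} w same odd with AdjWalk-parity w
  ... | inj₁ uv∈  = uv∈
  ... | inj₂ walk = ⊥-elim (not-¬ refl (begin
    colour x                       ≡⟨ sym same ⟩
    colour (lastV x s)             ≡⟨ walk ⟩
    colour x xor oddᵇ (length s)   ≡⟨ cong (colour x xor_) (IsOdd⇒oddᵇ odd) ⟩
    colour x xor true              ≡⟨ xor-comm (colour x) true ⟩
    not (colour x)                 ∎))

  data Ear (Vs : List (HV k)) (Es : List (HE k)) : HV k → Steps k → Set where
    end  : ∀ {x q y}   → Adj x q y → q ∉ Es → y ∈ Vs → Ear Vs Es x ((q , y) ∷ [])
    step : ∀ {x q y s} → Adj x q y → q ∉ Es → y ∉ Vs → Ear Vs Es y s → Ear Vs Es x ((q , y) ∷ s)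

  module _ {Vs : List (HV k)} {Es : List (HE k)} where

    Ear⇒AdjWalk : ∀ {x s} → Ear Vs Es x s → AdjWalk x s
    Ear⇒AdjWalk (end a _ _)    = a ∷ []
    Ear⇒AdjWalk (step a _ _ r) = a ∷ Ear⇒AdjWalk r

    Ear-head : ∀ {x q y s} → Ear Vs Es x ((q , y) ∷ s) → Adj x q y × q ∉ Es
    Ear-head (end a q∉ _)    = a , q∉
    Ear-head (step a q∉ _ _) = a , q∉

    Ear-fresh : ∀ {q x s} → q ∈ Es → Ear Vs Es x s → q ∉ map proj₁ s
    Ear-fresh q∈ (end _ q∉ _)    (here refl) = q∉ q∈
    Ear-fresh q∈ (step _ q∉ _ _) (here refl) = q∉ q∈
    Ear-fresh q∈ (step _ _ _ r)  (there q∈s) = Ear-fresh q∈ r q∈s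

    Ear-sameColour-even : ∀ {x s} → uv ∈ Es → Ear Vs Es x s → colour (lastV x s) ≡ colour x →
                          ¬ IsOdd (length s)
    Ear-sameColour-even uv∈ ear same odd =
      Ear-fresh uv∈ ear (oddWalk-sameColour-uses-uv (Ear⇒AdjWalk ear) same odd)

    Steps⇒Ear : ∀ {x₀ f} x s → StepsOK (H k) x s → 1 ≤ length s →
                All (x₀ ≢_) (map proj₂ s) → Unique (map proj₂ s) →
                All (λ w → w ∈ Vs → w ≡ x₀ ⊎ w ≡ f) (map proj₂ s) →
                lastV x s ≡ f → f ∈ Vs → All (_∉ Es) (map proj₁ s) → Ear Vs Es x s
    Steps⇒Ear x ((q , y) ∷ []) (j , _) _ _ _ _ refl f∈ (q∉ ∷ _) = end (Joins⇒Adj j) q∉ f∈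
    Steps⇒Ear x ((q , y) ∷ p ∷ s) (j , ok) _ (x₀≢y ∷ x₀≢) (y≢ ∷ distinct) (old⇒end ∷ old⇒end′)
              last≡f f∈ (q∉ ∷ fresh) =
      step (Joins⇒Adj j) q∉ y∉ (Steps⇒Ear y (p ∷ s) ok (s≤s z≤n) x₀≢ distinct old⇒end′ last≡f f∈ fresh)
      where
      y∉ : y ∉ Vs
      y∉ y∈ with old⇒end y∈
      ... | inj₁ y≡x₀ = x₀≢y (sym y≡x₀)
      ... | inj₂ y≡f  =
        All.lookup y≢ (subst (_∈ map proj₂ (p ∷ s)) last≡f (lastVertex-∈ y (p ∷ s) (s≤s z≤n))) y≡f

    IsEarOf⇒Ear : ∀ {x s} → IsEarOf (H k) Vs Es (x , s) → Ear Vs Es x s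
    IsEarOf⇒Ear {x} {s} ((ok , nonempty , (x∉ ∷ distinct) , _) , _ , f∈ , (_ ∷ old⇒end) , fresh) =
      Steps⇒Ear x s ok nonempty x∉ distinct old⇒end refl f∈ fresh

  -- OnT i and OnTᴱ i: vertices and edges of the copy T i; Private j and PrivateEdge j:
  -- those of T j other than the shared u, v and uv.
  OnT : Fin k → HV k → Set
  OnT i u     = ⊤
  OnT i v     = ⊤
  OnT i (c m) = m ≡ i
  OnT i (d m) = m ≡ i
  OnT i (e m) = m ≡ i

  Private : Fin k → HV k → Set
  Private j u     = ⊥
  Private j v     = ⊥
  Private j (c m) = m ≡ j
  Private j (d m) = m ≡ j
  Private j (e m) = m ≡ j

  PrivateEdge : Fin k → HE k → Set
  PrivateEdge j uv     = ⊥
  PrivateEdge j (vc m) = m ≡ j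
  PrivateEdge j (uc m) = m ≡ j
  PrivateEdge j (cd m) = m ≡ j
  PrivateEdge j (de m) = m ≡ j
  PrivateEdge j (eu m) = m ≡ j

  OnTᴱ : Fin k → HE k → Set
  OnTᴱ i uv     = ⊤
  OnTᴱ i (vc m) = m ≡ i
  OnTᴱ i (uc m) = m ≡ i
  OnTᴱ i (cd m) = m ≡ i
  OnTᴱ i (de m) = m ≡ i
  OnTᴱ i (eu m) = m ≡ i

  IsHub : HV k → Set
  IsHub w = w ≡ u ⊎ w ≡ v

  onT-private : ∀ {i j} w → OnT i w → Private j w → j ≡ i
  onT-private (c _) refl refl = refl
  onT-private (d _) refl refl = refl
  onT-private (e _) refl refl = refl

  onTᴱ-private : ∀ {i j} q → OnTᴱ i q → PrivateEdge j q → j ≡ i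
  onTᴱ-private (vc _) refl refl = refl
  onTᴱ-private (uc _) refl refl = refl
  onTᴱ-private (cd _) refl refl = refl
  onTᴱ-private (de _) refl refl = refl
  onTᴱ-private (eu _) refl refl = refl

  hub-colour : ∀ {w} → IsHub w → colour w ≡ false
  hub-colour (inj₁ refl) = refl
  hub-colour (inj₂ refl) = refl

  freshEar-endsAtHub : ∀ {Vs Es j x s} → u ∈ Vs → v ∈ Vs → (∀ {w} → w ∈ Vs → ¬ Private j w) →
                       Private j x → Ear Vs Es x s → IsHub (lastV x s)
  freshEar-endsAtHub u∈ v∈ fresh _    (end vc← _ _) = inj₂ refl
  freshEar-endsAtHub u∈ v∈ fresh _    (end uc← _ _) = inj₁ refl
  freshEar-endsAtHub u∈ v∈ fresh _    (end eu→ _ _) = inj₁ refl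
  freshEar-endsAtHub u∈ v∈ fresh refl (end cd→ _ d∈) = ⊥-elim (fresh d∈ refl)
  freshEar-endsAtHub u∈ v∈ fresh refl (end cd← _ c∈) = ⊥-elim (fresh c∈ refl)
  freshEar-endsAtHub u∈ v∈ fresh refl (end de→ _ e∈) = ⊥-elim (fresh e∈ refl)
  freshEar-endsAtHub u∈ v∈ fresh refl (end de← _ d∈) = ⊥-elim (fresh d∈ refl)
  freshEar-endsAtHub u∈ v∈ fresh _    (step vc← _ v∉ _) = ⊥-elim (v∉ v∈)
  freshEar-endsAtHub u∈ v∈ fresh _    (step uc← _ u∉ _) = ⊥-elim (u∉ u∈)
  freshEar-endsAtHub u∈ v∈ fresh _    (step eu→ _ u∉ _) = ⊥-elim (u∉ u∈)
  freshEar-endsAtHub u∈ v∈ fresh refl (step cd→ _ _ r) = freshEar-endsAtHub u∈ v∈ fresh refl r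
  freshEar-endsAtHub u∈ v∈ fresh refl (step cd← _ _ r) = freshEar-endsAtHub u∈ v∈ fresh refl r
  freshEar-endsAtHub u∈ v∈ fresh refl (step de→ _ _ r) = freshEar-endsAtHub u∈ v∈ fresh refl r
  freshEar-endsAtHub u∈ v∈ fresh refl (step de← _ _ r) = freshEar-endsAtHub u∈ v∈ fresh refl r

  record Confined (i : Fin k) (Vs : List (HV k)) (Es : List (HE k)) : Set where
    field
      touches : ∀ {w} → w ∈ Vs → OnT i w
      u∈      : u ∈ Vs
      v∈      : v ∈ Vs
      uv∈     : uv ∈ Es

  open Confined public

  module _ {i : Fin k} {Vs : List (HV k)} {Es : List (HE k)} where

    Confined-resp : ∀ {Vs′ Es′} → Vs ⊆ Vs′ → Vs′ ⊆ Vs → Es ⊆ Es′ →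
                    Confined i Vs Es → Confined i Vs′ Es′
    Confined-resp V⊆ ⊇V E⊆ B = record
      { touches = touches B ∘ ⊇V ; u∈ = V⊆ (u∈ B) ; v∈ = V⊆ (v∈ B) ; uv∈ = E⊆ (uv∈ B) }

    Confined-++ : ∀ {L M} → Confined i Vs Es → All (OnT i) L → Confined i (L ++ Vs) (M ++ Es)
    Confined-++ {L} {M} B onL = record
      { touches = [ All.lookup onL , touches B ]′ ∘ ∈-++⁻ L
      ; u∈      = ∈-++⁺ʳ L (u∈ B)
      ; v∈      = ∈-++⁺ʳ L (v∈ B)
      ; uv∈     = ∈-++⁺ʳ M (uv∈ B)
      }

    -- For j ≢ i the ear enters the copy T j, which is disjoint from Vs, so it must leave T j
    -- through a hub; but an ear between hubs avoiding uv is even.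
    oddHubEar-staysInT : ∀ {j x q y s} → Confined i Vs Es → Ear Vs Es x ((q , y) ∷ s) → IsHub x →
                         Private j y → IsOdd (suc (length s)) → j ≡ i
    oddHubEar-staysInT B (end _ _ y∈) _ p _ = onT-private _ (touches B y∈) p
    oddHubEar-staysInT {j} B ear@(step _ _ _ rest) hub p odd =
      decidable-stable (j ≟ i) λ j≢i →
        Ear-sameColour-even (uv∈ B) ear
          (trans (hub-colour (freshEar-endsAtHub (u∈ B) (v∈ B) (λ w∈ → j≢i ∘ onT-private _ (touches B w∈)) p rest))
                 (sym (hub-colour hub)))
          odd

    oddEar-firstEdge-private : ∀ {x q y s} → Confined i Vs Es → Ear Vs Es x ((q , y) ∷ s) → x ∈ Vs →
                               IsOdd (suc (length s)) → PrivateEdge i q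
    oddEar-firstEdge-private B ear x∈ odd with Ear-head ear
    ... | uv→ , q∉ = ⊥-elim (q∉ (uv∈ B))
    ... | uv← , q∉ = ⊥-elim (q∉ (uv∈ B))
    ... | vc→ , _  = oddHubEar-staysInT B ear (inj₂ refl) refl odd
    ... | uc→ , _  = oddHubEar-staysInT B ear (inj₁ refl) refl odd
    ... | eu← , _  = oddHubEar-staysInT B ear (inj₁ refl) refl odd
    ... | vc← , _  = touches B x∈
    ... | uc← , _  = touches B x∈
    ... | cd→ , _  = touches B x∈
    ... | cd← , _  = touches B x∈
    ... | de→ , _  = touches B x∈
    ... | de← , _  = touches B x∈
    ... | eu→ , _  = touches B x∈

  record Saturated (i : Fin k) (Vs : List (HV k)) (Es : List (HE k)) : Set where
    constructor saturated
    field
      confined      : Confined i Vs Es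
      privateEdges∈ : ∀ {q} → PrivateEdge i q → q ∈ Es

  saturated-noOddEar : ∀ {i Vs Es x s} → Saturated i Vs Es → Ear Vs Es x s → x ∈ Vs →
                       ¬ IsOdd (length s)
  saturated-noOddEar {s = _ ∷ _} (saturated B all∈) ear x∈ odd =
    proj₂ (Ear-head ear) (all∈ (oddEar-firstEdge-private B ear x∈ odd))

  privateEdges⇒∈ : ∀ {i Es q} → vc i ∈ Es → uc i ∈ Es → cd i ∈ Es → de i ∈ Es → eu i ∈ Es →
                   PrivateEdge i q → q ∈ Es
  privateEdges⇒∈ {q = vc _} vc∈ _ _ _ _ refl = vc∈
  privateEdges⇒∈ {q = uc _} _ uc∈ _ _ _ refl = uc∈
  privateEdges⇒∈ {q = cd _} _ _ cd∈ _ _ refl = cd∈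
  privateEdges⇒∈ {q = de _} _ _ _ de∈ _ refl = de∈
  privateEdges⇒∈ {q = eu _} _ _ _ _ eu∈ refl = eu∈

  -- Odd circuits and their odd ears

  SaturatedAfter : Fin k → List (HV k) → List (HE k) → HV k → Steps k → Set
  SaturatedAfter i Vs Es x s = Saturated i (verts {H k} (x , s) ++ Vs) (edges {H k} (x , s) ++ Es)

  record Triangle (i : Fin k) (Vs : List (HV k)) (Es : List (HE k)) : Set where
    constructor triangleState
    field
      confined : Confined i Vs Es
      c∈       : c i ∈ Vs
      d∉       : d i ∉ Vs
      e∉       : e i ∉ Vs
      vc∈      : vc i ∈ Es
      uc∈      : uc i ∈ Es

  record Pentagon (i : Fin k) (Vs : List (HV k)) (Es : List (HE k)) : Set where
    constructor pentagonState
    field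
      confined : Confined i Vs Es
      c∈       : c i ∈ Vs
      vc∈      : vc i ∈ Es
      cd∈      : cd i ∈ Es
      de∈      : de i ∈ Es
      eu∈      : eu i ∈ Es

  module _ {i : Fin k} {Vs : List (HV k)} {Es : List (HE k)} where

    triangle-squareEar-from-c : ∀ {s} → Triangle i Vs Es → Ear Vs Es (c i) ((cd i , d i) ∷ s) →
                                Unique (cd i ∷ map proj₁ s) →
                                SaturatedAfter i Vs Es (c i) ((cd i , d i) ∷ s)
    triangle-squareEar-from-c (triangleState _ _ d∉ _ _ _) (end cd→ _ d∈) _ = ⊥-elim (d∉ d∈)
    triangle-squareEar-from-c _ (step cd→ _ _ (end cd← _ _)) ((cd≢cd ∷ _) ∷ _) = ⊥-elim (cd≢cd refl)
    triangle-squareEar-from-c _ (step cd→ _ _ (step cd← _ _ _)) ((cd≢cd ∷ _) ∷ _) = ⊥-elim (cd≢cd refl)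
    triangle-squareEar-from-c (triangleState _ _ _ e∉ _ _) (step cd→ _ _ (end de→ _ e∈)) _ = ⊥-elim (e∉ e∈)
    triangle-squareEar-from-c _ (step cd→ _ _ (step de→ _ _ (end de← _ _))) (_ ∷ (de≢de ∷ _) ∷ _) =
      ⊥-elim (de≢de refl)
    triangle-squareEar-from-c _ (step cd→ _ _ (step de→ _ _ (step de← _ _ _))) (_ ∷ (de≢de ∷ _) ∷ _) =
      ⊥-elim (de≢de refl)
    triangle-squareEar-from-c (triangleState B _ _ _ vc∈ uc∈) (step cd→ _ _ (step de→ _ _ (end eu→ _ _))) _ =
      saturated (Confined-++ B (refl ∷ refl ∷ refl ∷ tt ∷ []))
        (privateEdges⇒∈ (∈-++⁺ʳ _ vc∈) (∈-++⁺ʳ _ uc∈) (here refl) (there (here refl)) (there (there (here refl))))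
    triangle-squareEar-from-c (triangleState B _ _ _ _ _) (step cd→ _ _ (step de→ _ _ (step eu→ _ u∉ _))) _ =
      ⊥-elim (u∉ (u∈ B))

    triangle-squareEar-from-u : ∀ {s} → Triangle i Vs Es → Ear Vs Es u ((eu i , e i) ∷ s) →
                                Unique (eu i ∷ map proj₁ s) →
                                SaturatedAfter i Vs Es u ((eu i , e i) ∷ s)
    triangle-squareEar-from-u (triangleState _ _ _ e∉ _ _) (end eu← _ e∈) _ = ⊥-elim (e∉ e∈)
    triangle-squareEar-from-u _ (step eu← _ _ (end eu→ _ _)) ((eu≢eu ∷ _) ∷ _) = ⊥-elim (eu≢eu refl)
    triangle-squareEar-from-u (triangleState B _ _ _ _ _) (step eu← _ _ (step eu→ _ u∉ _)) _ = ⊥-elim (u∉ (u∈ B))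
    triangle-squareEar-from-u (triangleState _ _ d∉ _ _ _) (step eu← _ _ (end de← _ d∈)) _ = ⊥-elim (d∉ d∈)
    triangle-squareEar-from-u _ (step eu← _ _ (step de← _ _ (end de→ _ _))) (_ ∷ (de≢de ∷ _) ∷ _) =
      ⊥-elim (de≢de refl)
    triangle-squareEar-from-u _ (step eu← _ _ (step de← _ _ (step de→ _ _ _))) (_ ∷ (de≢de ∷ _) ∷ _) =
      ⊥-elim (de≢de refl)
    triangle-squareEar-from-u (triangleState B _ _ _ vc∈ uc∈) (step eu← _ _ (step de← _ _ (end cd← _ _))) _ =
      saturated (Confined-++ B (tt ∷ refl ∷ refl ∷ refl ∷ []))
        (privateEdges⇒∈ (∈-++⁺ʳ _ vc∈) (∈-++⁺ʳ _ uc∈) (there (there (here refl))) (there (here refl)) (here refl))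
    triangle-squareEar-from-u (triangleState _ c∈ _ _ _ _) (step eu← _ _ (step de← _ _ (step cd← _ c∉ _))) _ =
      ⊥-elim (c∉ c∈)

    triangle-oddEar : ∀ {x s} → Triangle i Vs Es → Ear Vs Es x s → Unique (map proj₁ s) → x ∈ Vs →
                      IsOdd (length s) → SaturatedAfter i Vs Es x s
    triangle-oddEar {s = _ ∷ _} t@(triangleState B _ d∉ e∉ vc∈ uc∈) ear distinct x∈ odd
      with Ear-head ear | oddEar-firstEdge-private B ear x∈ odd
    ... | uv→ , _  | ()
    ... | uv← , _  | ()
    ... | vc→ , q∉ | refl = ⊥-elim (q∉ vc∈)
    ... | vc← , q∉ | refl = ⊥-elim (q∉ vc∈)
    ... | uc→ , q∉ | refl = ⊥-elim (q∉ uc∈)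
    ... | uc← , q∉ | refl = ⊥-elim (q∉ uc∈)
    ... | cd→ , _  | refl = triangle-squareEar-from-c t ear distinct
    ... | cd← , _  | refl = ⊥-elim (d∉ x∈)
    ... | de→ , _  | refl = ⊥-elim (d∉ x∈)
    ... | de← , _  | refl = ⊥-elim (e∉ x∈)
    ... | eu→ , _  | refl = ⊥-elim (e∉ x∈)
    ... | eu← , _  | refl = triangle-squareEar-from-u t ear distinct

    pentagon-chordEar-from-u : ∀ {s} → Pentagon i Vs Es → Ear Vs Es u ((uc i , c i) ∷ s) →
                               SaturatedAfter i Vs Es u ((uc i , c i) ∷ s)
    pentagon-chordEar-from-u (pentagonState B _ vc∈ cd∈ de∈ eu∈) (end uc→ _ _) =
      saturated (Confined-++ B (tt ∷ refl ∷ [])) (privateEdges⇒∈ (there vc∈) (here refl) (there cd∈) (there de∈) (there eu∈))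
    pentagon-chordEar-from-u (pentagonState _ c∈ _ _ _ _) (step uc→ _ c∉ _) = ⊥-elim (c∉ c∈)

    pentagon-chordEar-from-c : ∀ {s} → Pentagon i Vs Es → Ear Vs Es (c i) ((uc i , u) ∷ s) →
                               SaturatedAfter i Vs Es (c i) ((uc i , u) ∷ s)
    pentagon-chordEar-from-c (pentagonState B _ vc∈ cd∈ de∈ eu∈) (end uc← _ _) =
      saturated (Confined-++ B (refl ∷ tt ∷ [])) (privateEdges⇒∈ (there vc∈) (here refl) (there cd∈) (there de∈) (there eu∈))
    pentagon-chordEar-from-c (pentagonState B _ _ _ _ _) (step uc← _ u∉ _) = ⊥-elim (u∉ (u∈ B))

    pentagon-oddEar : ∀ {x s} → Pentagon i Vs Es → Ear Vs Es x s → x ∈ Vs →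
                      IsOdd (length s) → SaturatedAfter i Vs Es x s
    pentagon-oddEar {s = _ ∷ _} p@(pentagonState B _ vc∈ cd∈ de∈ eu∈) ear x∈ odd
      with Ear-head ear | oddEar-firstEdge-private B ear x∈ odd
    ... | uv→ , _  | ()
    ... | uv← , _  | ()
    ... | vc→ , q∉ | refl = ⊥-elim (q∉ vc∈)
    ... | vc← , q∉ | refl = ⊥-elim (q∉ vc∈)
    ... | uc→ , _  | refl = pentagon-chordEar-from-u p ear
    ... | uc← , _  | refl = pentagon-chordEar-from-c p ear
    ... | cd→ , q∉ | refl = ⊥-elim (q∉ cd∈)
    ... | cd← , q∉ | refl = ⊥-elim (q∉ cd∈)
    ... | de→ , q∉ | refl = ⊥-elim (q∉ de∈)
    ... | de← , q∉ | refl = ⊥-elim (q∉ de∈)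
    ... | eu→ , q∉ | refl = ⊥-elim (q∉ eu∈)
    ... | eu← , q∉ | refl = ⊥-elim (q∉ eu∈)

  confinedBy : ∀ {i Vs Es} → All (OnT i) Vs → u ∈ Vs → v ∈ Vs → Confined i Vs (uv ∷ Es)
  confinedBy onVs u∈ v∈ = record { touches = All.lookup onVs ; u∈ = u∈ ; v∈ = v∈ ; uv∈ = here refl }

  CircuitState : Fin k → List (HV k) → List (HE k) → Set
  CircuitState i Vs Es = Triangle i Vs Es ⊎ Pentagon i Vs Es

  CircuitState-resp : ∀ {i Vs Es Vs′ Es′} → Vs ⊆ Vs′ → Vs′ ⊆ Vs → Es ⊆ Es′ →
                      CircuitState i Vs Es → CircuitState i Vs′ Es′
  CircuitState-resp V⊆ ⊇V E⊆ (inj₁ (triangleState B c∈ d∉ e∉ vc∈ uc∈)) =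
    inj₁ (triangleState (Confined-resp V⊆ ⊇V E⊆ B) (V⊆ c∈) (d∉ ∘ ⊇V) (e∉ ∘ ⊇V) (E⊆ vc∈) (E⊆ uc∈))
  CircuitState-resp V⊆ ⊇V E⊆ (inj₂ (pentagonState B c∈ vc∈ cd∈ de∈ eu∈)) =
    inj₂ (pentagonState (Confined-resp V⊆ ⊇V E⊆ B) (V⊆ c∈) (E⊆ vc∈) (E⊆ cd∈) (E⊆ de∈) (E⊆ eu∈))

  -- The vertex list omits the first vertex of the closed walk, which is also its last.
  data CircuitThrough-uv (i : Fin k) : List (HV k) → List (HE k) → Set where
    triangle⁺ : CircuitThrough-uv i (v ∷ c i ∷ u ∷ []) (uv ∷ vc i ∷ uc i ∷ [])
    triangle⁻ : CircuitThrough-uv i (u ∷ c i ∷ v ∷ []) (uv ∷ uc i ∷ vc i ∷ [])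
    pentagon⁺ : CircuitThrough-uv i (v ∷ c i ∷ d i ∷ e i ∷ u ∷ []) (uv ∷ vc i ∷ cd i ∷ de i ∷ eu i ∷ [])
    pentagon⁻ : CircuitThrough-uv i (u ∷ e i ∷ d i ∷ c i ∷ v ∷ []) (uv ∷ eu i ∷ de i ∷ cd i ∷ vc i ∷ [])

  circuitThrough-uv : ∀ {z y R} → AdjWalk z ((uv , y) ∷ R) → Unique (y ∷ map proj₂ R) →
                      Unique (uv ∷ map proj₁ R) → lastV y R ≡ z →
                      ∃ λ i → CircuitThrough-uv i (y ∷ map proj₂ R) (uv ∷ map proj₁ R)
  circuitThrough-uv (uv→ ∷ []) _ _ ()
  circuitThrough-uv (uv→ ∷ uv← ∷ _) _ ((uv≢uv ∷ _) ∷ _) _ = ⊥-elim (uv≢uv refl)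
  circuitThrough-uv (uv→ ∷ vc→ ∷ []) _ _ ()
  circuitThrough-uv (uv→ ∷ vc→ ∷ vc← ∷ _) ((_ ∷ v≢v ∷ _) ∷ _) _ _ = ⊥-elim (v≢v refl)
  circuitThrough-uv {R = _ ∷ _ ∷ R} (uv→ ∷ vc→ {i} ∷ uc← ∷ _) (_ ∷ _ ∷ U) _ closed
    with refl ← returningWalk-nil {H k} u R U closed = i , triangle⁺
  circuitThrough-uv (uv→ ∷ vc→ ∷ cd→ ∷ []) _ _ ()
  circuitThrough-uv (uv→ ∷ vc→ ∷ cd→ ∷ cd← ∷ _) (_ ∷ (_ ∷ c≢c ∷ _) ∷ _) _ _ = ⊥-elim (c≢c refl)
  circuitThrough-uv (uv→ ∷ vc→ ∷ cd→ ∷ de→ ∷ []) _ _ ()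
  circuitThrough-uv (uv→ ∷ vc→ ∷ cd→ ∷ de→ ∷ de← ∷ _) (_ ∷ _ ∷ (_ ∷ d≢d ∷ _) ∷ _) _ _ = ⊥-elim (d≢d refl)
  circuitThrough-uv {R = _ ∷ _ ∷ _ ∷ _ ∷ R} (uv→ ∷ vc→ {i} ∷ cd→ ∷ de→ ∷ eu→ ∷ _) (_ ∷ _ ∷ _ ∷ _ ∷ U) _ closed
    with refl ← returningWalk-nil {H k} u R U closed = i , pentagon⁺
  circuitThrough-uv (uv← ∷ []) _ _ ()
  circuitThrough-uv (uv← ∷ uv→ ∷ _) _ ((uv≢uv ∷ _) ∷ _) _ = ⊥-elim (uv≢uv refl)
  circuitThrough-uv (uv← ∷ uc→ ∷ []) _ _ ()
  circuitThrough-uv (uv← ∷ uc→ ∷ uc← ∷ _) ((_ ∷ u≢u ∷ _) ∷ _) _ _ = ⊥-elim (u≢u refl)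
  circuitThrough-uv {R = _ ∷ _ ∷ R} (uv← ∷ uc→ {i} ∷ vc← ∷ _) (_ ∷ _ ∷ U) _ closed
    with refl ← returningWalk-nil {H k} v R U closed = i , triangle⁻
  circuitThrough-uv (uv← ∷ uc→ ∷ cd→ ∷ []) _ _ ()
  circuitThrough-uv (uv← ∷ uc→ ∷ cd→ ∷ cd← ∷ _) (_ ∷ (_ ∷ c≢c ∷ _) ∷ _) _ _ = ⊥-elim (c≢c refl)
  circuitThrough-uv (uv← ∷ uc→ ∷ cd→ ∷ de→ ∷ []) _ _ ()
  circuitThrough-uv (uv← ∷ uc→ ∷ cd→ ∷ de→ ∷ de← ∷ _) (_ ∷ _ ∷ (_ ∷ d≢d ∷ _) ∷ _) _ _ = ⊥-elim (d≢d refl)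
  circuitThrough-uv (uv← ∷ uc→ ∷ cd→ ∷ de→ ∷ eu→ ∷ _) ((_ ∷ _ ∷ _ ∷ u≢u ∷ _) ∷ _) _ _ = ⊥-elim (u≢u refl)
  circuitThrough-uv (uv← ∷ eu← ∷ []) _ _ ()
  circuitThrough-uv (uv← ∷ eu← ∷ eu→ ∷ _) ((_ ∷ u≢u ∷ _) ∷ _) _ _ = ⊥-elim (u≢u refl)
  circuitThrough-uv (uv← ∷ eu← ∷ de← ∷ []) _ _ ()
  circuitThrough-uv (uv← ∷ eu← ∷ de← ∷ de→ ∷ _) (_ ∷ (_ ∷ e≢e ∷ _) ∷ _) _ _ = ⊥-elim (e≢e refl)
  circuitThrough-uv (uv← ∷ eu← ∷ de← ∷ cd← ∷ []) _ _ ()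
  circuitThrough-uv (uv← ∷ eu← ∷ de← ∷ cd← ∷ cd→ ∷ _) (_ ∷ _ ∷ (_ ∷ d≢d ∷ _) ∷ _) _ _ = ⊥-elim (d≢d refl)
  circuitThrough-uv (uv← ∷ eu← ∷ de← ∷ cd← ∷ uc← ∷ _) ((_ ∷ _ ∷ _ ∷ u≢u ∷ _) ∷ _) _ _ = ⊥-elim (u≢u refl)
  circuitThrough-uv {R = _ ∷ _ ∷ _ ∷ _ ∷ R} (uv← ∷ eu← {i} ∷ de← ∷ cd← ∷ vc← ∷ _) (_ ∷ _ ∷ _ ∷ _ ∷ U) _ closed
    with refl ← returningWalk-nil {H k} v R U closed = i , pentagon⁻

  circuitThrough-uv-state : ∀ {i Vs Es} → CircuitThrough-uv i Vs Es → CircuitState i Vs Es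
  circuitThrough-uv-state triangle⁺ =
    inj₁ (triangleState (confinedBy (tt ∷ refl ∷ tt ∷ []) (there (there (here refl))) (here refl))
                        (there (here refl)) (All¬⇒¬Any ((λ ()) ∷ (λ ()) ∷ (λ ()) ∷ []))
                        (All¬⇒¬Any ((λ ()) ∷ (λ ()) ∷ (λ ()) ∷ [])) (there (here refl)) (there (there (here refl))))
  circuitThrough-uv-state triangle⁻ =
    inj₁ (triangleState (confinedBy (tt ∷ refl ∷ tt ∷ []) (here refl) (there (there (here refl))))
                        (there (here refl)) (All¬⇒¬Any ((λ ()) ∷ (λ ()) ∷ (λ ()) ∷ []))
                        (All¬⇒¬Any ((λ ()) ∷ (λ ()) ∷ (λ ()) ∷ [])) (there (there (here refl))) (there (here refl)))
  circuitThrough-uv-state pentagon⁺ =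
    inj₂ (pentagonState (confinedBy (tt ∷ refl ∷ refl ∷ refl ∷ tt ∷ []) (there (there (there (there (here refl))))) (here refl))
                        (there (here refl)) (there (here refl)) (there (there (here refl)))
                        (there (there (there (here refl)))) (there (there (there (there (here refl))))))
  circuitThrough-uv-state pentagon⁻ =
    inj₂ (pentagonState (confinedBy (tt ∷ refl ∷ refl ∷ refl ∷ tt ∷ []) (here refl) (there (there (there (there (here refl))))))
                        (there (there (there (here refl)))) (there (there (there (there (here refl)))))
                        (there (there (there (here refl)))) (there (there (here refl))) (there (here refl)))

  oddCircuit-state : ∀ {x s} → IsCircuit (H k) (x , s) → IsOdd (length s) →
                     ∃ λ i → CircuitState i (verts {H k} (x , s)) (edges {H k} (x , s))
  oddCircuit-state {x} {s} (ok , long , closed , distinctV , distinctE) odd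
    with ∈-map⁻ proj₁ (oddWalk-sameColour-uses-uv (StepsOK⇒AdjWalk x s ok) (cong colour closed) odd)
  ... | (_ , y) , uvy∈s , refl with ∈-∃++ uvy∈s
  ... | A , B , refl =
    let i , shape = circuitThrough-uv (StepsOK⇒AdjWalk _ _ (proj₁ rotated))
                      (Unique-resp-↭ σV distinctV) (Unique-resp-↭ σE distinctE) (proj₂ rotated)
    in i , CircuitState-resp (there ∘ ∈-resp-↭ (↭-sym σV)) ⊇V (∈-resp-↭ (↭-sym σE)) (circuitThrough-uv-state shape)
    where
    rotated = closedWalk-rotate {H k} x A ((uv , y) ∷ B) ok closed
    σ : A ++ (uv , y) ∷ B ↭ (uv , y) ∷ B ++ A
    σ = ++-comm A ((uv , y) ∷ B)
    σV = ↭-map⁺ proj₂ σ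
    σE = ↭-map⁺ proj₁ σ
    ⊇V : x ∷ map proj₂ (A ++ (uv , y) ∷ B) ⊆ y ∷ map proj₂ (B ++ A)
    ⊇V (here refl) = ∈-resp-↭ σV (subst (_∈ _) closed (lastVertex-∈ x (A ++ (uv , y) ∷ B) (≤-trans (n≤1+n 1) long)))
    ⊇V (there w∈)  = ∈-resp-↭ σV w∈

  oddEar-saturates : ∀ {i Vs Es x s} → CircuitState i Vs Es → IsEarOf (H k) Vs Es (x , s) →
                     IsOdd (length s) → SaturatedAfter i Vs Es x s
  oddEar-saturates (inj₁ t) ear@((_ , _ , _ , distinct) , x∈ , _) odd =
    triangle-oddEar t (IsEarOf⇒Ear ear) distinct x∈ odd
  oddEar-saturates (inj₂ p) ear@(_ , x∈ , _) odd = pentagon-oddEar p (IsEarOf⇒Ear ear) x∈ odd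

  oddEarDecomposition-≤2 : ∀ n → HasOddEarDecomposition (H k) n → n ≤ 2
  oddEarDecomposition-≤2 _ ([] , () , _)
  oddEarDecomposition-≤2 _ (_ ∷ [] , _ , _ , refl) = s≤s z≤n
  oddEarDecomposition-≤2 _ (_ ∷ _ ∷ [] , _ , _ , refl) = s≤s (s≤s z≤n)
  oddEarDecomposition-≤2 _
    (_ ∷ _ ∷ _ ∷ _ , (circuit , ear₁ , ear₂@(_ , x₂∈ , _) , _) , oddC ∷ odd₁ ∷ odd₂ ∷ _ , refl) =
    ⊥-elim (saturated-noOddEar (oddEar-saturates (proj₂ (oddCircuit-state circuit oddC)) ear₁ odd₁)
                               (IsEarOf⇒Ear ear₂) x₂∈ odd₂)

  -- Ear-decompositions of H k

  triangle : Fin k → Walk (H k)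
  triangle i = u , (uv , v) ∷ (vc i , c i) ∷ (uc i , u) ∷ []

  apexPath squarePath : Fin k → Walk (H k)
  apexPath j   = v , (vc j , c j) ∷ (uc j , u) ∷ []
  squarePath j = c j , (cd j , d j) ∷ (de j , e j) ∷ (eu j , u) ∷ []

  triangle-isCircuit : ∀ i → IsCircuit (H k) (triangle i)
  triangle-isCircuit i =
    (inj₁ refl , inj₁ refl , inj₂ refl , tt) , s≤s (s≤s z≤n) , refl ,
    (((λ ()) ∷ (λ ()) ∷ []) ∷ ((λ ()) ∷ []) ∷ [] ∷ []) ,
    (((λ ()) ∷ (λ ()) ∷ []) ∷ ((λ ()) ∷ []) ∷ [] ∷ [])

  apexPath-isEar : ∀ {j Vs Es} → v ∈ Vs → u ∈ Vs → c j ∉ Vs → vc j ∉ Es → uc j ∉ Es →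
                   IsEarOf (H k) Vs Es (apexPath j)
  apexPath-isEar v∈ u∈ c∉ vc∉ uc∉ =
    ((inj₁ refl , inj₂ refl , tt) , s≤s z≤n ,
     (((λ ()) ∷ (λ ()) ∷ []) ∷ ((λ ()) ∷ []) ∷ [] ∷ []) , (((λ ()) ∷ []) ∷ [] ∷ [])) ,
    v∈ , u∈ ,
    ((λ _ → inj₁ refl) ∷ (⊥-elim ∘ c∉) ∷ (λ _ → inj₂ refl) ∷ []) ,
    (vc∉ ∷ uc∉ ∷ [])

  squarePath-isEar : ∀ {j Vs Es} → c j ∈ Vs → u ∈ Vs → d j ∉ Vs → e j ∉ Vs →
                     cd j ∉ Es → de j ∉ Es → eu j ∉ Es → IsEarOf (H k) Vs Es (squarePath j)
  squarePath-isEar c∈ u∈ d∉ e∉ cd∉ de∉ eu∉ =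
    ((inj₁ refl , inj₁ refl , inj₁ refl , tt) , s≤s z≤n ,
     (((λ ()) ∷ (λ ()) ∷ (λ ()) ∷ []) ∷ ((λ ()) ∷ (λ ()) ∷ []) ∷ ((λ ()) ∷ []) ∷ [] ∷ []) ,
     (((λ ()) ∷ (λ ()) ∷ []) ∷ ((λ ()) ∷ []) ∷ [] ∷ [])) ,
    c∈ , u∈ ,
    ((λ _ → inj₁ refl) ∷ (⊥-elim ∘ d∉) ∷ (⊥-elim ∘ e∉) ∷ (λ _ → inj₂ refl) ∷ []) ,
    (cd∉ ∷ de∉ ∷ eu∉ ∷ [])

  squarePath-earOfTriangle : ∀ i → IsEarOf (H k) (verts {H k} (triangle i)) (edges {H k} (triangle i)) (squarePath i)
  squarePath-earOfTriangle i =
    squarePath-isEar (there (there (here refl))) (here refl)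
      (All¬⇒¬Any ((λ ()) ∷ (λ ()) ∷ (λ ()) ∷ (λ ()) ∷ [])) (All¬⇒¬Any ((λ ()) ∷ (λ ()) ∷ (λ ()) ∷ (λ ()) ∷ []))
      (All¬⇒¬Any ((λ ()) ∷ (λ ()) ∷ (λ ()) ∷ [])) (All¬⇒¬Any ((λ ()) ∷ (λ ()) ∷ (λ ()) ∷ []))
      (All¬⇒¬Any ((λ ()) ∷ (λ ()) ∷ (λ ()) ∷ []))

  twoOddEars : Fin k → HasOddEarDecomposition (H k) 2
  twoOddEars i =
    triangle i ∷ squarePath i ∷ [] ,
    (triangle-isCircuit i , squarePath-earOfTriangle i , tt) ,
    (1 , refl) ∷ (1 , refl) ∷ [] ,
    refl

  gadgetEars : List (Fin k) → List (Walk (H k))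
  gadgetEars = concatMap (λ j → apexPath j ∷ squarePath j ∷ [])

  gadgetEars-∈ : ∀ {j js} → j ∈ js → apexPath j ∈ gadgetEars js × squarePath j ∈ gadgetEars js
  gadgetEars-∈ (here refl) = here refl , there (here refl)
  gadgetEars-∈ (there j∈)  = let apex∈ , square∈ = gadgetEars-∈ j∈ in there (there apex∈) , there (there square∈)

  gadgetEars-oddEars : ∀ js → NumOddEars (H k) (gadgetEars js) ≡ length js
  gadgetEars-oddEars []       = refl
  gadgetEars-oddEars (j ∷ js) = cong suc (gadgetEars-oddEars js)

  record FreshGadget (j : Fin k) (Vs : List (HV k)) (Es : List (HE k)) : Set where
    field
      freshVertices : ∀ {w} → w ∈ Vs → ¬ Private j w
      freshEdges    : ∀ {q} → q ∈ Es → ¬ PrivateEdge j q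

  open FreshGadget public

  FreshGadget-[] : ∀ {j} → FreshGadget j [] []
  FreshGadget-[] = record { freshVertices = λ () ; freshEdges = λ () }

  FreshGadget-++ : ∀ {i j Vs Es} L M → i ≢ j → FreshGadget j Vs Es → All (OnT i) L → All (OnTᴱ i) M →
                   FreshGadget j (L ++ Vs) (M ++ Es)
  FreshGadget-++ L M i≢j F onL onM = record
    { freshVertices = [ (λ w∈ → i≢j ∘ sym ∘ onT-private _ (All.lookup onL w∈)) , freshVertices F ]′ ∘ ∈-++⁻ L
    ; freshEdges    = [ (λ q∈ → i≢j ∘ sym ∘ onTᴱ-private _ (All.lookup onM q∈)) , freshEdges F ]′ ∘ ∈-++⁻ M
    }

  gadgetEars-ok : ∀ js {Vs Es} → u ∈ Vs → v ∈ Vs → Unique js → All (λ j → FreshGadget j Vs Es) js →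
                  EarsOK (H k) Vs Es (gadgetEars js)
  gadgetEars-ok []       _ _ _ _ = tt
  gadgetEars-ok (j ∷ js) {Vs} {Es} u∈ v∈ (j≢ ∷ distinct) (F ∷ fresh) =
    apexPath-isEar v∈ u∈ (new refl) (newᴱ refl) (newᴱ refl) ,
    squarePath-isEar (there (here refl)) (there (there (here refl)))
      (∉-++ (All¬⇒¬Any ((λ ()) ∷ (λ ()) ∷ (λ ()) ∷ [])) (new refl))
      (∉-++ (All¬⇒¬Any ((λ ()) ∷ (λ ()) ∷ (λ ()) ∷ [])) (new refl))
      (∉-++ (All¬⇒¬Any ((λ ()) ∷ (λ ()) ∷ [])) (newᴱ refl))
      (∉-++ (All¬⇒¬Any ((λ ()) ∷ (λ ()) ∷ [])) (newᴱ refl))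
      (∉-++ (All¬⇒¬Any ((λ ()) ∷ (λ ()) ∷ [])) (newᴱ refl)) ,
    gadgetEars-ok js (there (there (there (here refl)))) (there (there (there (there (here refl))))) distinct
      (All.zipWith (λ (j≢j′ , F′) → FreshGadget-++ (c j ∷ d j ∷ e j ∷ u ∷ v ∷ c j ∷ u ∷ [])
                                                    (cd j ∷ de j ∷ eu j ∷ vc j ∷ uc j ∷ []) j≢j′ F′
                                                    (refl ∷ refl ∷ refl ∷ tt ∷ tt ∷ refl ∷ tt ∷ [])
                                                    (refl ∷ refl ∷ refl ∷ refl ∷ refl ∷ []))
                   (j≢ , fresh))
    where
    new : ∀ {w} → Private j w → w ∉ Vs
    new p w∈ = freshVertices F w∈ p
    newᴱ : ∀ {q} → PrivateEdge j q → q ∉ Es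
    newᴱ p q∈ = freshEdges F q∈ p

module _ {k : ℕ} where

  others : List (Fin (suc k))
  others = map suc (allFin k)

  others-∈ : ∀ j → apexPath (suc j) ∈ gadgetEars others × squarePath (suc j) ∈ gadgetEars others
  others-∈ j = gadgetEars-∈ (∈-map⁺ suc (∈-allFin j))

  earDecomposition : List (Walk (H (suc k)))
  earDecomposition = triangle zero ∷ squarePath zero ∷ gadgetEars others

  earDecomposition-isEarDecomposition : IsEarDecomposition (H (suc k)) earDecomposition
  earDecomposition-isEarDecomposition =
    triangle-isCircuit zero ,
    squarePath-earOfTriangle zero ,
    gadgetEars-ok others (there (there (there (here refl)))) (there (there (there (there (there (here refl))))))
      (Unique-map⁺ suc-injective (allFin⁺ k))
      (All-map⁺ (All.tabulate λ _ → FreshGadget-++ (c zero ∷ d zero ∷ e zero ∷ u ∷ u ∷ v ∷ c zero ∷ u ∷ [])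
                                                    (cd zero ∷ de zero ∷ eu zero ∷ uv ∷ vc zero ∷ uc zero ∷ [])
                                                    (λ ()) FreshGadget-[]
                                                    (refl ∷ refl ∷ refl ∷ tt ∷ tt ∷ tt ∷ refl ∷ tt ∷ [])
                                                    (refl ∷ refl ∷ refl ∷ tt ∷ refl ∷ refl ∷ [])))

  earDecomposition-spanning : Spanning (H (suc k)) earDecomposition
  earDecomposition-spanning = covered⇒Spanning {H (suc k)} earDecomposition coverV coverE
    where
    coverV : ∀ w → ∃ λ P → P ∈ earDecomposition × w ∈ verts {H (suc k)} P
    coverV u           = triangle zero , here refl , here refl
    coverV v           = triangle zero , here refl , there (here refl)
    coverV (c zero)    = triangle zero , here refl , there (there (here refl))
    coverV (d zero)    = squarePath zero , there (here refl) , there (here refl)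
    coverV (e zero)    = squarePath zero , there (here refl) , there (there (here refl))
    coverV (c (suc j)) = squarePath (suc j) , there (there (proj₂ (others-∈ j))) , here refl
    coverV (d (suc j)) = squarePath (suc j) , there (there (proj₂ (others-∈ j))) , there (here refl)
    coverV (e (suc j)) = squarePath (suc j) , there (there (proj₂ (others-∈ j))) , there (there (here refl))
    coverE : ∀ q → ∃ λ P → P ∈ earDecomposition × q ∈ edges {H (suc k)} P
    coverE uv           = triangle zero , here refl , here refl
    coverE (vc zero)    = triangle zero , here refl , there (here refl)
    coverE (uc zero)    = triangle zero , here refl , there (there (here refl))
    coverE (cd zero)    = squarePath zero , there (here refl) , here refl
    coverE (de zero)    = squarePath zero , there (here refl) , there (here refl)
    coverE (eu zero)    = squarePath zero , there (here refl) , there (there (here refl))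
    coverE (vc (suc j)) = apexPath (suc j) , there (there (proj₁ (others-∈ j))) , here refl
    coverE (uc (suc j)) = apexPath (suc j) , there (there (proj₁ (others-∈ j))) , there (here refl)
    coverE (cd (suc j)) = squarePath (suc j) , there (there (proj₂ (others-∈ j))) , here refl
    coverE (de (suc j)) = squarePath (suc j) , there (there (proj₂ (others-∈ j))) , there (here refl)
    coverE (eu (suc j)) = squarePath (suc j) , there (there (proj₂ (others-∈ j))) , there (there (here refl))

  earDecomposition-oddEars : NumOddEars (H (suc k)) earDecomposition ≡ suc (suc k)
  earDecomposition-oddEars =
    cong (2 +_) (trans (gadgetEars-oddEars others) (trans (length-map suc (allFin k)) (length-tabulate (λ j → j))))

  phiBar-H : PhiBarAtLeast (H (suc k)) (suc (suc k))
  phiBar-H = earDecomposition , earDecomposition-isEarDecomposition , earDecomposition-spanning ,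
             ≤-reflexive (sym earDecomposition-oddEars)

-- The hypothesis 2 ≤ k only excludes k = 0; the argument works for every k ≥ 1.
proposition3p4 : (k : ℕ) → 2 ≤ k → BetaIs (H k) 2 × PhiBarAtLeast (H k) k
proposition3p4 (suc k) _ =
  (twoOddEars zero , oddEarDecomposition-≤2) , PhiBarAtLeast-mono (n≤1+n (suc k)) phiBar-H
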